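{- Let $\mathfrak S$ be an algebraic signature and let $g:X\to Y$ be a morphism of algebraic $\mathfrak S$-structures. Then there exists a factorization $g=g'\circ h$ with $h:X\to X'$ and $g':X'\to Y$ such that $h$ is a relative $\mathrm{Tot}$-cell complex in $\mathrm{Alg}(\mathfrak S)$ and $X'$ is total over $Y$ with respect to $g'$. Moreover, the triple $(X',h,g')$ is uniquely determined by $g$ up to unique isomorphism.
   Context: An algebraic signature $\mathfrak S=(S,P\sqcup F)$ consists of sorts $S$, predicate symbols $p:s_1\times\dots\times s_n$ and function symbols $f:s_1\times\dots\times s_n\to s$ ($n\ge0$). An algebraic structure has carriers $X_s$, relations $p_X\subseteq X_{s_1}\times\dots\times X_{s_n}$ and partial functions $f_X:X_{s_1}\times\dots\times X_{s_n}\rightharpoonup X_s$; morphisms are sortwise functions preserving the relations and the graphs of the partial functions. The category $\mathrm{Alg}(\mathfrak S)$ is complete and cocomplete. For a function symbol $f:s_1\times\dots\times s_n\to s$, let $[f\downarrow]:A_f\to B_f$ be the inclusion where $A_f$ has exactly $n$ distinct elements $a_1,\dots,a_n$ ($a_i$ of sort $s_i$) and empty relations and functions, and $B_f$ has these elements plus one further element $b$ of sort $s$, empty predicates, $f_{B_f}(a_1,\dots,a_n)=b$, and all other partial functions nowhere defined (this is the classifying morphism of the totality sequent $v_1\downarrow\land\dots\land v_n\downarrow\implies f(v_1,\dots,v_n)\downarrow$). $\mathrm{Tot}=\{[f\downarrow]\mid f\in F\}$. For a class $M$ of morphisms of a cocomplete category, the relative $M$-cell complexes form the least class containing $M$ and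 closed under set-indexed coproducts, pushouts along arbitrary maps, and compositions of countable sequences (canonical maps $A_0\to\operatorname{colim}_nA_n$). For $g':X'\to Y$, $X'$ is total over $Y$ (w.r.t. $g'$) if for all $f\in F$ and $x_1,\dots,x_n\in X'$, if $f_Y(g'(x_1),\dots,g'(x_n))$ is defined then $f_{X'}(x_1,\dots,x_n)$ is defined. -}

module Defs where

open import Level using (0ℓ)
open import Data.Nat using (ℕ; zero; suc)
open import Data.Fin using (Fin)
open import Data.Maybe using (Maybe; just; nothing)
open import Data.Product using (Σ; _×_; _,_; proj₁)
open import Data.Sum using (_⊎_; inj₁; inj₂)
open import Data.Empty using (⊥)
open import Relation.Binary.Bundles using (Setoid)
open import Relation.Binary.PropositionalEquality as P using (_≡_)

record Signature : Set₁ where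
  field
    Sort   : Set
    Pred   : Set
    parity : Pred → ℕ
    pargs  : (p : Pred) → Fin (parity p) → Sort
    Fun    : Set
    farity : Fun → ℕ
    fargs  : (f : Fun) → Fin (farity f) → Sort
    fres   : Fun → Sort

module _ (𝔖 : Signature) where
  open Signature 𝔖

  -- Algebraic structures: sorted carriers (setoids, since Agda has no
  -- quotients), relations, and partial functions given by their graphs.

  record Struct : Set₁ where
    field
      car : Sort → Setoid 0ℓ 0ℓ
    Elt : Sort → Set
    Elt s = Setoid.Carrier (car s)
    _≈[_]_ : ∀ {s} → Elt s → (s' : Sort) → Elt s → Set
    _≈[_]_ {s} x _ y = Setoid._≈_ (car s) x y
    PArgs : Pred → Set
    PArgs p = (i : Fin (parity p)) → Elt (pargs p i)
    FArgs : Fun → Set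
    FArgs f = (i : Fin (farity f)) → Elt (fargs f i)
    field
      rel      : (p : Pred) → PArgs p → Set
      rel-resp : ∀ p {xs ys : PArgs p} →
                 (∀ i → Setoid._≈_ (car (pargs p i)) (xs i) (ys i)) →
                 rel p xs → rel p ys
      fun      : (f : Fun) → FArgs f → Elt (fres f) → Set
      fun-resp : ∀ f {xs ys : FArgs f} {y y' : Elt (fres f)} →
                 (∀ i → Setoid._≈_ (car (fargs f i)) (xs i) (ys i)) →
                 Setoid._≈_ (car (fres f)) y y' →
                 fun f xs y → fun f ys y'
      fun-functional : ∀ f {xs : FArgs f} {y y' : Elt (fres f)} →
                 fun f xs y → fun f xs y' → Setoid._≈_ (car (fres f)) y y'

  open Struct

  record Hom (X Y : Struct) : Set where
    field
      map      : ∀ s → Elt X s → Elt Y s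
      map-cong : ∀ s {x y : Elt X s} →
                 Setoid._≈_ (car X s) x y → Setoid._≈_ (car Y s) (map s x) (map s y)
      pres-rel : ∀ p (xs : PArgs X p) → rel X p xs →
                 rel Y p (λ i → map (pargs p i) (xs i))
      pres-fun : ∀ f (xs : FArgs X f) (y : Elt X (fres f)) → fun X f xs y →
                 fun Y f (λ i → map (fargs f i) (xs i)) (map (fres f) y)

  open Hom

  _≈H_ : ∀ {X Y} → Hom X Y → Hom X Y → Set
  _≈H_ {X} {Y} h k = ∀ s (x : Elt X s) → Setoid._≈_ (car Y s) (map h s x) (map k s x)

  idH : ∀ {X} → Hom X X
  idH {X} = record
    { map = λ s x → x
    ; map-cong = λ s e → e
    ; pres-rel = λ p xs r → r
    ; pres-fun = λ f xs y r → r }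

  _∘H_ : ∀ {X Y Z} → Hom Y Z → Hom X Y → Hom X Z
  g ∘H h = record
    { map = λ s x → map g s (map h s x)
    ; map-cong = λ s e → map-cong g s (map-cong h s e)
    ; pres-rel = λ p xs r → pres-rel g p _ (pres-rel h p xs r)
    ; pres-fun = λ f xs y r → pres-fun g f _ _ (pres-fun h f xs y r) }

  record IsIso {X Y : Struct} (h : Hom X Y) : Set where
    field
      inv   : Hom Y X
      inv-l : (inv ∘H h) ≈H idH
      inv-r : (h ∘H inv) ≈H idH

  Iso : Struct → Struct → Set
  Iso X Y = Σ (Hom X Y) IsIso

  ∃!H : ∀ {X Y} → (Hom X Y → Set) → Set
  ∃!H {X} {Y} P = Σ (Hom X Y) λ u → P u × (∀ (u' : Hom X Y) → P u' → u' ≈H u)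

  IsCoproduct : {I : Set} (A : I → Struct) {C : Struct} → (∀ i → Hom (A i) C) → Set₁
  IsCoproduct {I} A {C} ι =
    ∀ (Z : Struct) (z : ∀ i → Hom (A i) Z) →
      ∃!H {C} {Z} λ u → ∀ i → (u ∘H ι i) ≈H z i

  IsPushout : ∀ {A B C D} (m : Hom A B) (u : Hom A C) (v : Hom C D) (w : Hom B D) → Set₁
  IsPushout {A} {B} {C} {D} m u v w =
    ((v ∘H u) ≈H (w ∘H m)) ×
    (∀ (Z : Struct) (v' : Hom C Z) (w' : Hom B Z) → (v' ∘H u) ≈H (w' ∘H m) →
       ∃!H {D} {Z} λ t → ((t ∘H v) ≈H v') × ((t ∘H w) ≈H w'))

  IsSeqColimit : (A : ℕ → Struct) (a : ∀ n → Hom (A n) (A (suc n)))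
                 {L : Struct} (c : ∀ n → Hom (A n) L) → Set₁
  IsSeqColimit A a {L} c =
    (∀ n → (c (suc n) ∘H a n) ≈H c n) ×
    (∀ (Z : Struct) (z : ∀ n → Hom (A n) Z) → (∀ n → (z (suc n) ∘H a n) ≈H z n) →
       ∃!H {L} {Z} λ t → ∀ n → (t ∘H c n) ≈H z n)

  MorClass : Set₂
  MorClass = ∀ {A B : Struct} → Hom A B → Set₁

  data Cell (M : MorClass) : ∀ {X Y : Struct} → Hom X Y → Set₁ where
    base      : ∀ {A B} {m : Hom A B} → M m → Cell M m
    coproduct : ∀ {I : Set} {A B : I → Struct} (m : ∀ i → Hom (A i) (B i)) →
                (∀ i → Cell M (m i)) →
                ∀ {CA CB} (ιA : ∀ i → Hom (A i) CA) (ιB : ∀ i → Hom (B i) CB) →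
                IsCoproduct A ιA → IsCoproduct B ιB →
                (h : Hom CA CB) → (∀ i → (h ∘H ιA i) ≈H (ιB i ∘H m i)) →
                Cell M h
    pushout   : ∀ {A B C D} (m : Hom A B) → Cell M m →
                (u : Hom A C) (v : Hom C D) (w : Hom B D) →
                IsPushout m u v w → Cell M v
    sequence  : ∀ (A : ℕ → Struct) (a : ∀ n → Hom (A n) (A (suc n))) →
                (∀ n → Cell M (a n)) →
                ∀ {L} (c : ∀ n → Hom (A n) L) → IsSeqColimit A a c →
                Cell M (c 0)

  -- The totality maps  [f↓] : A_f → B_f.
  -- A_f has exactly the n distinct elements a_1,…,a_n (a_i of sort s_i);
  -- B_f additionally has b of sort fres f, with f(a_1,…,a_n) = b.

  -- elements of sort t of A_f : indices i with s_i = t  (equal iff same index)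
  AfElt : Fun → Sort → Set
  AfElt f t = Σ (Fin (farity f)) λ i → fargs f i ≡ t

  BfElt : Fun → Sort → Set
  BfElt f t = AfElt f t ⊎ (fres f ≡ t)

  keyA : ∀ {f t} → AfElt f t → Fin (farity f)
  keyA = proj₁

  keyB : ∀ {f t} → BfElt f t → Maybe (Fin (farity f))
  keyB (inj₁ a) = just (proj₁ a)
  keyB (inj₂ _) = nothing

  keySetoid : {C K : Set} → (C → K) → Setoid 0ℓ 0ℓ
  keySetoid {C} key = record
    { Carrier = C
    ; _≈_ = λ x y → key x ≡ key y
    ; isEquivalence = record
      { refl = P.refl
      ; sym = P.sym
      ; trans = P.trans } }

  data BfGraph (f : Fun) : (g : Fun) → ((i : Fin (farity g)) → BfElt f (fargs g i)) →
               BfElt f (fres g) → Set where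
    mk : ∀ {xs y} → (∀ i → keyB (xs i) ≡ just i) → keyB y ≡ nothing →
         BfGraph f f xs y

  Af : Fun → Struct
  Af f = record
    { car = λ t → keySetoid (keyA {f} {t})
    ; rel = λ p xs → ⊥
    ; rel-resp = λ p e ()
    ; fun = λ g xs y → ⊥
    ; fun-resp = λ g e e' ()
    ; fun-functional = λ g () }

  Bf : Fun → Struct
  Bf f = record
    { car = λ t → keySetoid (keyB {f} {t})
    ; rel = λ p xs → ⊥
    ; rel-resp = λ p e ()
    ; fun = BfGraph f
    ; fun-resp = λ { g e e' (mk k k') → mk (λ i → P.trans (P.sym (e i)) (k i)) (P.trans (P.sym e') k') }
    ; fun-functional = λ { g (mk _ k) (mk _ k') → P.trans k (P.sym k') } }

  totInc : (f : Fun) → Hom (Af f) (Bf f)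
  totInc f = record
    { map = λ t a → inj₁ a
    ; map-cong = λ t e → P.cong just e
    ; pres-rel = λ p xs ()
    ; pres-fun = λ g xs y () }

  data Tot : MorClass where
    tot : (f : Fun) → Tot (totInc f)

  TotalOver : ∀ {X' Y} → Hom X' Y → Set
  TotalOver {X'} {Y} g' =
    ∀ f (xs : FArgs X' f) (y : Elt Y (fres f)) →
      fun Y f (λ i → map g' (fargs f i) (xs i)) y →
      Σ (Elt X' (fres f)) λ x → fun X' f xs x

{-# OPTIONS --safe #-}
module Submission where

-- X' is a free completion of X over Y: its elements are formal terms over X in which f(t₁,…,tₙ)
-- may be formed exactly when f is defined in Y on the images of the tᵢ (each node records that
-- image), two terms being identified when they are congruent or evaluate to equal elements of X.
-- Totality of g' holds by construction. Filtering by term depth, Level n → Level (n+1) is a pushout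
-- of a coproduct of maps [f↓], one for each application defined in Y on terms of depth ≤ n, and h
-- is, up to Level 0 ≅ X, the composite of this sequence. Uniqueness is formal: Tot-cell complexes
-- are epimorphisms with the left lifting property against every g' making its domain total, so two
-- such factorisations are related by lifts in both directions, which are mutually inverse.

open import Data.Nat using (ℕ; zero; suc; _≤_; s≤s; _≤′_; ≤′-refl; ≤′-step; _⊔_)
open import Data.Nat.Properties using (n≤1+n; ≤′⇒≤; ≤⇒≤′; ≤-total; m≤m⊔n; m≤n⊔m)
open import Data.Fin using (Fin)
open import Data.Fin.Properties using (¬Fin0)
open import Data.Unit using (⊤; tt)
open import Data.Maybe using (just; nothing)
open import Data.Maybe.Properties using (just-injective)
open import Data.Sum using (_⊎_; inj₁; inj₂)
open import Data.Sum.Properties using (inj₁-injective; inj₂-injective)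
open import Data.Empty using (⊥; ⊥-elim)
open import Data.Product using (Σ; _×_; _,_; proj₁; proj₂)
open import Relation.Binary.Bundles using (Setoid)
open import Relation.Binary.PropositionalEquality using (_≡_; refl; sym; trans; cong; subst)
open import Defs

common-bound : ∀ {m} (P : Fin m → ℕ → Set) → (∀ {k a b} → a ≤ b → P k a → P k b) →
               (∀ k → Σ ℕ (P k)) → Σ ℕ λ N → ∀ k → P k N
common-bound {zero} P mono bounds = 0 , λ ()
common-bound {suc m} P mono bounds with common-bound (λ k → P (Fin.suc k)) mono (λ k → bounds (Fin.suc k))
... | N , below-N = proj₁ (bounds Fin.zero) ⊔ N , λ where
  Fin.zero → mono (m≤m⊔n _ N) (proj₂ (bounds Fin.zero))
  (Fin.suc k) → mono (m≤n⊔m _ N) (below-N k)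

module Factorisation (𝔖 : Signature) where
  open Signature 𝔖
  open Struct
  open Hom

  infix  4 _≈ₕ_
  infixr 9 _∘_

  _∘_ : ∀ {X Y Z : Struct 𝔖} → Hom 𝔖 Y Z → Hom 𝔖 X Y → Hom 𝔖 X Z
  _∘_ = _∘H_ 𝔖

  _≈ₕ_ : ∀ {X Y : Struct 𝔖} → Hom 𝔖 X Y → Hom 𝔖 X Y → Set
  _≈ₕ_ = _≈H_ 𝔖

  module _ (X : Struct 𝔖) {s : Sort} where
    open Setoid (car X s) public
      using () renaming (_≈_ to _∋_≈_; refl to ≈-refl; sym to ≈-sym; trans to ≈-trans)

  -- Tot-cell complexes are epic and lift against total maps

  coproduct-jointly-epic : ∀ {I} {A : I → Struct 𝔖} {C} {ι : ∀ i → Hom 𝔖 (A i) C} →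
                           IsCoproduct 𝔖 A ι → ∀ {Z} (p q : Hom 𝔖 C Z) →
                           (∀ i → p ∘ ι i ≈ₕ q ∘ ι i) → p ≈ₕ q
  coproduct-jointly-epic {ι = ι} isCop {Z} p q e s x =
    ≈-trans Z (unique p e s x) (≈-sym Z (unique q (λ i s y → ≈-refl Z) s x))
    where unique = proj₂ (proj₂ (isCop Z (λ i → q ∘ ι i)))

  pushout-jointly-epic : ∀ {A B C D} {m : Hom 𝔖 A B} {u : Hom 𝔖 A C} {v : Hom 𝔖 C D} {w : Hom 𝔖 B D} →
                         IsPushout 𝔖 m u v w → ∀ {Z} (p q : Hom 𝔖 D Z) →
                         p ∘ v ≈ₕ q ∘ v → p ∘ w ≈ₕ q ∘ w → p ≈ₕ q
  pushout-jointly-epic {v = v} {w} (square , isPO) {Z} p q ev ew s x =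
    ≈-trans Z (unique p (ev , ew) s x)
      (≈-sym Z (unique q ((λ s y → ≈-refl Z) , (λ s y → ≈-refl Z)) s x))
    where unique = proj₂ (proj₂ (isPO Z (q ∘ v) (q ∘ w) (λ s y → map-cong q s (square s y))))

  colimit-jointly-epic : ∀ {A a L} {c : ∀ n → Hom 𝔖 (A n) L} → IsSeqColimit 𝔖 A a c →
                         ∀ {Z} (p q : Hom 𝔖 L Z) → (∀ n → p ∘ c n ≈ₕ q ∘ c n) → p ≈ₕ q
  colimit-jointly-epic {c = c} (cocone , isColim) {Z} p q e s x =
    ≈-trans Z (unique p e s x) (≈-sym Z (unique q (λ n s y → ≈-refl Z) s x))
    where unique = proj₂ (proj₂ (isColim Z (λ n → q ∘ c n) (λ n s y → map-cong q s (cocone n s y))))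

  Epic : ∀ {A B} → Hom 𝔖 A B → Set₁
  Epic {B = B} m = ∀ {Z} (p q : Hom 𝔖 B Z) → p ∘ m ≈ₕ q ∘ m → p ≈ₕ q

  coproduct-epic : ∀ {I} {A B : I → Struct 𝔖} {m : ∀ i → Hom 𝔖 (A i) (B i)} →
                   (∀ i → Epic (m i)) →
                   ∀ {CA CB} {ιA : ∀ i → Hom 𝔖 (A i) CA} {ιB : ∀ i → Hom 𝔖 (B i) CB} →
                   IsCoproduct 𝔖 B ιB →
                   (h : Hom 𝔖 CA CB) → (∀ i → h ∘ ιA i ≈ₕ ιB i ∘ m i) → Epic h
  coproduct-epic epic {CB = CB} {ιA} {ιB} isCop h comm {Z} p q e =
    coproduct-jointly-epic {ι = ιB} isCop p q λ i → epic i (p ∘ ιB i) (q ∘ ιB i) λ s a →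
      ≈-trans Z (map-cong p s (≈-sym CB (comm i s a)))
        (≈-trans Z (e s (map (ιA i) s a)) (map-cong q s (comm i s a)))

  pushout-epic : ∀ {A B C D} {m : Hom 𝔖 A B} → Epic m →
                 {u : Hom 𝔖 A C} {v : Hom 𝔖 C D} {w : Hom 𝔖 B D} → IsPushout 𝔖 m u v w → Epic v
  pushout-epic {D = D} {m} epic {u} {v} {w} po@(square , _) {Z} p q e =
    pushout-jointly-epic {m = m} {u} {v} {w} po p q e (epic (p ∘ w) (q ∘ w) λ s a →
      ≈-trans Z (map-cong p s (≈-sym D (square s a)))
        (≈-trans Z (e s (map u s a)) (map-cong q s (square s a))))

  sequence-epic : ∀ {A a} → (∀ n → Epic (a n)) → ∀ {L} {c : ∀ n → Hom 𝔖 (A n) L} →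
                  IsSeqColimit 𝔖 A a c → Epic (c 0)
  sequence-epic {A} {a} epic {L} {c} colim@(cocone , _) {Z} p q e =
    colimit-jointly-epic {A} {a} {c = c} colim p q agree
    where
      agree : ∀ n → p ∘ c n ≈ₕ q ∘ c n
      agree zero = e
      agree (suc n) = epic n (p ∘ c (suc n)) (q ∘ c (suc n)) λ s x →
        ≈-trans Z (map-cong p s (cocone n s x))
          (≈-trans Z (agree n s x) (map-cong q s (≈-sym L (cocone n s x))))

  infix 4 _⧄_

  _⧄_ : ∀ {A B W V} → Hom 𝔖 A B → Hom 𝔖 W V → Set
  _⧄_ {A} {B} {W} {V} m p =
    (u : Hom 𝔖 A W) (v : Hom 𝔖 B V) → p ∘ u ≈ₕ v ∘ m →
    Σ (Hom 𝔖 B W) λ l → l ∘ m ≈ₕ u × p ∘ l ≈ₕ v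

  coproduct-lifts : ∀ {I} {A B : I → Struct 𝔖} {m : ∀ i → Hom 𝔖 (A i) (B i)}
                    {W V} {p : Hom 𝔖 W V} → (∀ i → m i ⧄ p) →
                    ∀ {CA CB} {ιA : ∀ i → Hom 𝔖 (A i) CA} {ιB : ∀ i → Hom 𝔖 (B i) CB} →
                    IsCoproduct 𝔖 A ιA → IsCoproduct 𝔖 B ιB →
                    (h : Hom 𝔖 CA CB) → (∀ i → h ∘ ιA i ≈ₕ ιB i ∘ m i) → h ⧄ p
  coproduct-lifts {B = B} {m} {W} {V} {p} lifts {ιA = ιA} {ιB} copA copB h comm u v e =
    l , lh , pl
    where
      liftᵢ : ∀ i → Σ (Hom 𝔖 (B i) W) λ l → l ∘ m i ≈ₕ u ∘ ιA i × p ∘ l ≈ₕ v ∘ ιB i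
      liftᵢ i = lifts i (u ∘ ιA i) (v ∘ ιB i)
                  λ s a → ≈-trans V (e s (map (ιA i) s a)) (map-cong v s (comm i s a))
      copair = copB W (λ i → proj₁ (liftᵢ i))
      l = proj₁ copair
      lh : l ∘ h ≈ₕ u
      lh = coproduct-jointly-epic {ι = ιA} copA (l ∘ h) u λ i s a →
        ≈-trans W (map-cong l s (comm i s a))
          (≈-trans W (proj₁ (proj₂ copair) i s (map (m i) s a)) (proj₁ (proj₂ (liftᵢ i)) s a))
      pl : p ∘ l ≈ₕ v
      pl = coproduct-jointly-epic {ι = ιB} copB (p ∘ l) v λ i s b →
        ≈-trans V (map-cong p s (proj₁ (proj₂ copair) i s b)) (proj₂ (proj₂ (liftᵢ i)) s b)

  pushout-lifts : ∀ {A B C D} {m : Hom 𝔖 A B} {W V} {p : Hom 𝔖 W V} → m ⧄ p →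
                  {u₀ : Hom 𝔖 A C} {v₀ : Hom 𝔖 C D} {w₀ : Hom 𝔖 B D} →
                  IsPushout 𝔖 m u₀ v₀ w₀ → v₀ ⧄ p
  pushout-lifts {m = m} {W} {V} {p} lifts {u₀} {v₀} {w₀} po@(square , isPO) u v e =
    l , lv₀ , pl
    where
      liftB = lifts (u ∘ u₀) (v ∘ w₀) λ s a → ≈-trans V (e s (map u₀ s a)) (map-cong v s (square s a))
      gluing = isPO W u (proj₁ liftB) λ s a → ≈-sym W (proj₁ (proj₂ liftB) s a)
      l = proj₁ gluing
      lv₀ = proj₁ (proj₁ (proj₂ gluing))
      lw₀ = proj₂ (proj₁ (proj₂ gluing))
      pl : p ∘ l ≈ₕ v
      pl = pushout-jointly-epic {m = m} {u₀} {v₀} {w₀} po (p ∘ l) v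
        (λ s c → ≈-trans V (map-cong p s (lv₀ s c)) (e s c))
        (λ s b → ≈-trans V (map-cong p s (lw₀ s b)) (proj₂ (proj₂ liftB) s b))

  sequence-lifts : ∀ {A a} {W V} {p : Hom 𝔖 W V} → (∀ n → a n ⧄ p) →
                   ∀ {L} {c : ∀ n → Hom 𝔖 (A n) L} → IsSeqColimit 𝔖 A a c → c 0 ⧄ p
  sequence-lifts {A} {a} {W} {V} {p} lifts {c = c} colim@(cocone , isColim) u v e =
    l , lc 0 , pl
    where
      liftₙ : ∀ n → Σ (Hom 𝔖 (A n) W) λ l → p ∘ l ≈ₕ v ∘ c n
      liftStep : ∀ n → Σ (Hom 𝔖 (A (suc n)) W) λ l →
                   l ∘ a n ≈ₕ proj₁ (liftₙ n) × p ∘ l ≈ₕ v ∘ c (suc n)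
      liftₙ zero = u , e
      liftₙ (suc n) = proj₁ (liftStep n) , proj₂ (proj₂ (liftStep n))
      liftStep n = lifts n (proj₁ (liftₙ n)) (v ∘ c (suc n))
        λ s x → ≈-trans V (proj₂ (liftₙ n) s x) (≈-sym V (map-cong v s (cocone n s x)))
      glued = isColim W (λ n → proj₁ (liftₙ n)) (λ n → proj₁ (proj₂ (liftStep n)))
      l = proj₁ glued
      lc = proj₁ (proj₂ glued)
      pl : p ∘ l ≈ₕ v
      pl = colimit-jointly-epic {A} {a} {c = c} colim (p ∘ l) v λ n s x →
        ≈-trans V (map-cong p s (lc n s x)) (proj₂ (liftₙ n) s x)

  generators : ∀ f (k : Fin (farity f)) → BfElt 𝔖 f (fargs f k)
  generators f k = inj₁ (k , refl)

  Bf-defined : ∀ f → fun (Bf 𝔖 f) f (generators f) (inj₂ refl)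
  Bf-defined f = mk (λ k → refl) refl

  totInc-epic : ∀ f → Epic (totInc 𝔖 f)
  totInc-epic f p q e s (inj₁ a) = e s a
  totInc-epic f {Z} p q e .(fres f) (inj₂ refl) =
    fun-functional Z f
      (fun-resp Z f (λ k → e (fargs f k) (k , refl)) (≈-refl Z)
        (pres-fun p f (generators f) (inj₂ refl) (Bf-defined f)))
      (pres-fun q f (generators f) (inj₂ refl) (Bf-defined f))

  module TotIncLift (f : Fun) {W V : Struct 𝔖} (p : Hom 𝔖 W V) (total : TotalOver 𝔖 p)
                    (u : Hom 𝔖 (Af 𝔖 f) W) (v : Hom 𝔖 (Bf 𝔖 f) V)
                    (square : p ∘ u ≈ₕ v ∘ totInc 𝔖 f) where
    args : FArgs W f
    args k = map u (fargs f k) (k , refl)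

    defined-below : fun V f (λ k → map p _ (args k)) (map v (fres f) (inj₂ refl))
    defined-below = fun-resp V f (λ k → ≈-sym V (square (fargs f k) (k , refl))) (≈-refl V)
                      (pres-fun v f (generators f) (inj₂ refl) (Bf-defined f))

    value : Σ (Elt W (fres f)) λ c → fun W f args c
    value = total f args (map v (fres f) (inj₂ refl)) defined-below

    lift-map : ∀ t → BfElt 𝔖 f t → Elt W t
    lift-map t (inj₁ a) = map u t a
    lift-map .(fres f) (inj₂ refl) = proj₁ value

    lift-cong : ∀ t (x y : BfElt 𝔖 f t) → keyB 𝔖 x ≡ keyB 𝔖 y → W ∋ lift-map t x ≈ lift-map t y
    lift-cong t (inj₁ (k , _)) (inj₁ (.k , _)) refl = map-cong u t refl
    lift-cong .(fres f) (inj₂ refl) (inj₂ refl) _ = ≈-refl W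
    lift-cong t (inj₁ _) (inj₂ _) ()
    lift-cong t (inj₂ _) (inj₁ _) ()

    lift-generator : ∀ k (b : BfElt 𝔖 f (fargs f k)) → keyB 𝔖 b ≡ just k → W ∋ args k ≈ lift-map _ b
    lift-generator k (inj₁ (.k , _)) refl = map-cong u (fargs f k) refl

    lift-value : (b : BfElt 𝔖 f (fres f)) → keyB 𝔖 b ≡ nothing → W ∋ proj₁ value ≈ lift-map _ b
    lift-value (inj₂ refl) refl = ≈-refl W

    lift-pres-fun : ∀ g (xs : (k : Fin (farity g)) → BfElt 𝔖 f (fargs g k)) (y : BfElt 𝔖 f (fres g)) →
                    BfGraph 𝔖 f g xs y → fun W g (λ k → lift-map _ (xs k)) (lift-map _ y)
    lift-pres-fun .f xs y (mk isGen isNew) =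
      fun-resp W f (λ k → lift-generator k (xs k) (isGen k)) (lift-value y isNew) (proj₂ value)

    l : Hom 𝔖 (Bf 𝔖 f) W
    l = record { map = lift-map ; map-cong = λ t {x} {y} → lift-cong t x y
               ; pres-rel = λ _ _ () ; pres-fun = lift-pres-fun }

    pl : p ∘ l ≈ₕ v
    pl s (inj₁ a) = square s a
    pl .(fres f) (inj₂ refl) = fun-functional V f (pres-fun p f args _ (proj₂ value)) defined-below

  totInc-lifts : ∀ f {W V} {p : Hom 𝔖 W V} → TotalOver 𝔖 p → totInc 𝔖 f ⧄ p
  totInc-lifts f {W} {p = p} total u v square = l , (λ s a → ≈-refl W) , pl
    where open TotIncLift f p total u v square

  cell-epic : ∀ {A B} {m : Hom 𝔖 A B} → Cell 𝔖 (Tot 𝔖) m → Epic m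
  cell-epic (base (tot f)) = totInc-epic f
  cell-epic (coproduct m cells ιA ιB _ copB h comm) =
    coproduct-epic {m = m} (λ i → cell-epic (cells i)) {ιA = ιA} {ιB} copB h comm
  cell-epic (pushout m cell u v w po) = pushout-epic {m = m} (cell-epic cell) {u} {v} {w} po
  cell-epic (sequence A a cells c colim) = sequence-epic {A} {a} (λ n → cell-epic (cells n)) {c = c} colim

  cell-lifts : ∀ {A B} {m : Hom 𝔖 A B} → Cell 𝔖 (Tot 𝔖) m →
               ∀ {W V} (p : Hom 𝔖 W V) → TotalOver 𝔖 p → m ⧄ p
  cell-lifts (base (tot f)) p total = totInc-lifts f {p = p} total
  cell-lifts (coproduct m cells ιA ιB copA copB h comm) p total =
    coproduct-lifts {m = m} {p = p} (λ i → cell-lifts (cells i) p total) {ιA = ιA} {ιB} copA copB h comm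
  cell-lifts (pushout m cell u v w po) p total =
    pushout-lifts {m = m} {p = p} (cell-lifts cell p total) {u} {v} {w} po
  cell-lifts (sequence A a cells c colim) p total =
    sequence-lifts {A} {a} {p = p} (λ n → cell-lifts (cells n) p total) {c = c} colim

  factorisation-unique :
    ∀ {X Y X' X''} {g : Hom 𝔖 X Y}
      {h : Hom 𝔖 X X'} {g' : Hom 𝔖 X' Y} → g' ∘ h ≈ₕ g → Cell 𝔖 (Tot 𝔖) h → TotalOver 𝔖 g' →
      {k : Hom 𝔖 X X''} {g'' : Hom 𝔖 X'' Y} → g'' ∘ k ≈ₕ g → Cell 𝔖 (Tot 𝔖) k → TotalOver 𝔖 g'' →
    Σ (Iso 𝔖 X' X'') λ φ →
      (proj₁ φ ∘ h ≈ₕ k × g'' ∘ proj₁ φ ≈ₕ g') ×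
      (∀ (ψ : Iso 𝔖 X' X'') →
        proj₁ ψ ∘ h ≈ₕ k → g'' ∘ proj₁ ψ ≈ₕ g' → proj₁ ψ ≈ₕ proj₁ φ)
  factorisation-unique {_} {Y} {X'} {X''} {h = h} {g'} comm' cell-h total'
                                         {k} {g''} comm'' cell-k total'' =
    (φ , isIso) , (φh , g''φ) , λ ψ ψh _ → cell-epic cell-h (proj₁ ψ) φ λ s x →
      ≈-trans X'' (ψh s x) (≈-sym X'' (φh s x))
    where
      forth = cell-lifts cell-h g'' total'' k g' λ s x → ≈-trans Y (comm'' s x) (≈-sym Y (comm' s x))
      back = cell-lifts cell-k g' total' h g'' λ s x → ≈-trans Y (comm' s x) (≈-sym Y (comm'' s x))
      φ = proj₁ forth
      φh = proj₁ (proj₂ forth)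
      g''φ = proj₂ (proj₂ forth)
      φ⁻¹ = proj₁ back
      φ⁻¹k = proj₁ (proj₂ back)
      isIso : IsIso 𝔖 φ
      isIso = record
        { inv = φ⁻¹
        ; inv-l = cell-epic cell-h (φ⁻¹ ∘ φ) (idH 𝔖) λ s x →
            ≈-trans X' (map-cong φ⁻¹ s (φh s x)) (φ⁻¹k s x)
        ; inv-r = cell-epic cell-k (φ ∘ φ⁻¹) (idH 𝔖) λ s x →
            ≈-trans X'' (map-cong φ s (φ⁻¹k s x)) (φh s x) }

  -- Coproducts of totality maps

  module TotCoproduct {I : Set} (f : I → Fun) where

    AElt : Sort → Set
    AElt t = Σ I λ i → AfElt 𝔖 (f i) t

    generatorKey : ∀ {t} → AElt t → Σ I λ i → Fin (farity (f i))
    generatorKey (i , k , _) = i , k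

    ∐Af : Struct 𝔖
    ∐Af = record
      { car = λ t → keySetoid 𝔖 (generatorKey {t})
      ; rel = λ _ _ → ⊥ ; rel-resp = λ _ _ ()
      ; fun = λ _ _ _ → ⊥ ; fun-resp = λ _ _ _ () ; fun-functional = λ _ () }

    ιA : ∀ i → Hom 𝔖 (Af 𝔖 (f i)) ∐Af
    ιA i = record { map = λ t a → i , a ; map-cong = λ t → cong (i ,_)
                  ; pres-rel = λ _ _ () ; pres-fun = λ _ _ _ () }

    ∐Af-isCoproduct : IsCoproduct 𝔖 (λ i → Af 𝔖 (f i)) ιA
    ∐Af-isCoproduct Z z = copair , (λ i s a → ≈-refl Z) , (λ _ e s x → e (proj₁ x) s (proj₂ x))
      where
        copair-cong : ∀ t (x y : AElt t) → generatorKey x ≡ generatorKey y →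
                      Z ∋ map (z (proj₁ x)) t (proj₂ x) ≈ map (z (proj₁ y)) t (proj₂ y)
        copair-cong t (i , k , _) (.i , .k , _) refl = map-cong (z i) t refl
        copair : Hom 𝔖 ∐Af Z
        copair = record { map = λ t x → map (z (proj₁ x)) t (proj₂ x) ; map-cong = λ t → copair-cong t _ _
                        ; pres-rel = λ _ _ () ; pres-fun = λ _ _ _ () }

    -- The new elements of two copies of one nullary symbol c are both the value of c, so the
    -- coproduct must identify them: they are keyed by the symbol, all other new elements by index.
    newKeyFrom : I → ℕ → Fun ⊎ I
    newKeyFrom i zero = inj₁ (f i)
    newKeyFrom i (suc _) = inj₂ i

    newKey : I → Fun ⊎ I
    newKey i = newKeyFrom i (farity (f i))

    newKey-injective : ∀ i j → newKey i ≡ newKey j → i ≡ j ⊎ (f i ≡ f j × farity (f i) ≡ 0)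
    newKey-injective i j = compare (farity (f i)) (farity (f j)) refl
      where
        compare : ∀ n m → n ≡ farity (f i) → newKeyFrom i n ≡ newKeyFrom j m →
                  i ≡ j ⊎ (f i ≡ f j × farity (f i) ≡ 0)
        compare zero zero n≡ e = inj₂ (inj₁-injective e , sym n≡)
        compare (suc n) (suc m) _ e = inj₁ (inj₂-injective e)
        compare zero (suc m) _ ()
        compare (suc n) zero _ ()

    BElt : Sort → Set
    BElt t = Σ I λ i → BfElt 𝔖 (f i) t

    BKey : Set
    BKey = (Σ I λ i → Fin (farity (f i))) ⊎ (Fun ⊎ I)

    eltKey : ∀ {t} → BElt t → BKey
    eltKey (i , inj₁ (k , _)) = inj₁ (i , k)
    eltKey (i , inj₂ _) = inj₂ (newKey i)

    data ∐BfGraph : (g : Fun) → ((k : Fin (farity g)) → BElt (fargs g k)) → BElt (fres g) → Set where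
      copy : ∀ i {xs y} → (∀ k → eltKey (xs k) ≡ inj₁ (i , k)) → eltKey y ≡ inj₂ (newKey i) →
             ∐BfGraph (f i) xs y

    applicationKey : Fun → (n : ℕ) → (Fin n → BKey) → Fun ⊎ I
    applicationKey g zero _ = inj₁ g
    applicationKey g (suc n) ks with ks Fin.zero
    ... | inj₁ (i , _) = inj₂ i
    ... | inj₂ _ = inj₁ g

    newKeyFrom-arguments : ∀ i n (ks : Fin n → BKey) →
                           (∀ k → Σ (Fin (farity (f i))) λ k' → ks k ≡ inj₁ (i , k')) →
                           newKeyFrom i n ≡ applicationKey (f i) n ks
    newKeyFrom-arguments i zero ks _ = refl
    newKeyFrom-arguments i (suc n) ks isGen rewrite proj₂ (isGen Fin.zero) = refl

    ∐BfGraph-key : ∀ {g xs y} → ∐BfGraph g xs y →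
                   eltKey y ≡ inj₂ (applicationKey g (farity g) (λ k → eltKey (xs k)))
    ∐BfGraph-key (copy i isGen isNew) =
      trans isNew (cong inj₂ (newKeyFrom-arguments i _ _ (λ k → _ , isGen k)))

    ∐BfGraph-resp : ∀ g {xs ys : (k : Fin (farity g)) → BElt (fargs g k)} {y y' : BElt (fres g)} →
                    (∀ k → eltKey (xs k) ≡ eltKey (ys k)) → eltKey y ≡ eltKey y' →
                    ∐BfGraph g xs y → ∐BfGraph g ys y'
    ∐BfGraph-resp .(f i) exs ey (copy i isGen isNew) =
      copy i (λ k → trans (sym (exs k)) (isGen k)) (trans (sym ey) isNew)

    ∐Bf : Struct 𝔖
    ∐Bf = record
      { car = λ t → keySetoid 𝔖 (eltKey {t})
      ; rel = λ _ _ → ⊥ ; rel-resp = λ _ _ ()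
      ; fun = ∐BfGraph ; fun-resp = ∐BfGraph-resp
      ; fun-functional = λ g p q → trans (∐BfGraph-key p) (sym (∐BfGraph-key q)) }

    module _ (i : I) where
      ιB-cong : ∀ {t} (b b' : BfElt 𝔖 (f i) t) → keyB 𝔖 b ≡ keyB 𝔖 b' → eltKey (i , b) ≡ eltKey (i , b')
      ιB-cong (inj₁ _) (inj₁ _) e = cong (λ k → inj₁ (i , k)) (just-injective e)
      ιB-cong (inj₂ _) (inj₂ _) e = refl
      ιB-cong (inj₁ _) (inj₂ _) ()
      ιB-cong (inj₂ _) (inj₁ _) ()

      ιB-generator : ∀ {t k} (b : BfElt 𝔖 (f i) t) → keyB 𝔖 b ≡ just k → eltKey (i , b) ≡ inj₁ (i , k)
      ιB-generator (inj₁ _) refl = refl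

      ιB-new : ∀ {t} (b : BfElt 𝔖 (f i) t) → keyB 𝔖 b ≡ nothing → eltKey (i , b) ≡ inj₂ (newKey i)
      ιB-new (inj₂ _) refl = refl

      ιB : Hom 𝔖 (Bf 𝔖 (f i)) ∐Bf
      ιB = record
        { map = λ t b → i , b
        ; map-cong = λ t {b} {b'} → ιB-cong b b'
        ; pres-rel = λ _ _ ()
        ; pres-fun = λ { .(f i) xs y (mk isGen isNew) →
            copy i (λ k → ιB-generator (xs k) (isGen k)) (ιB-new y isNew) } }

    nullary-values-agree : ∀ {Z t} (g g' : Fun) → g ≡ g' → farity g ≡ 0 →
                           (z : Hom 𝔖 (Bf 𝔖 g) Z) (z' : Hom 𝔖 (Bf 𝔖 g') Z)
                           (e : fres g ≡ t) (e' : fres g' ≡ t) →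
                           Z ∋ map z t (inj₂ e) ≈ map z' t (inj₂ e')
    nullary-values-agree {Z} g .g refl nullary z z' refl refl =
      fun-functional Z g
        (fun-resp Z g (λ k → ⊥-elim (¬Fin0 (subst Fin nullary k))) (≈-refl Z)
          (pres-fun z g (generators g) (inj₂ refl) (Bf-defined g)))
        (pres-fun z' g (generators g) (inj₂ refl) (Bf-defined g))

    module Copair (Z : Struct 𝔖) (z : ∀ i → Hom 𝔖 (Bf 𝔖 (f i)) Z) where
      copair-map : ∀ {t} → BElt t → Elt Z t
      copair-map {t} (i , b) = map (z i) t b

      copair-new-cong : ∀ {t} i j (e : fres (f i) ≡ t) (e' : fres (f j) ≡ t) →
                        i ≡ j ⊎ (f i ≡ f j × farity (f i) ≡ 0) →
                        Z ∋ copair-map (i , inj₂ e) ≈ copair-map (j , inj₂ e')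
      copair-new-cong i .i e e' (inj₁ refl) = map-cong (z i) _ refl
      copair-new-cong i j e e' (inj₂ (same , nullary)) =
        nullary-values-agree (f i) (f j) same nullary (z i) (z j) e e'

      copair-cong : ∀ {t} (x y : BElt t) → eltKey x ≡ eltKey y → Z ∋ copair-map x ≈ copair-map y
      copair-cong (i , inj₁ (k , _)) (.i , inj₁ (.k , _)) refl = map-cong (z i) _ refl
      copair-cong (i , inj₂ e) (j , inj₂ e') eq =
        copair-new-cong i j e e' (newKey-injective i j (inj₂-injective eq))
      copair-cong (i , inj₁ _) (j , inj₂ _) ()
      copair-cong (i , inj₂ _) (j , inj₁ _) ()

      copair-pres-fun : ∀ g xs y → ∐BfGraph g xs y → fun Z g (λ k → copair-map (xs k)) (copair-map y)
      copair-pres-fun .(f i) xs y (copy i isGen isNew) =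
        fun-resp Z (f i) (λ k → copair-cong (i , generators (f i) k) (xs k) (sym (isGen k)))
          (copair-cong (i , inj₂ refl) y (sym isNew))
          (pres-fun (z i) (f i) (generators (f i)) (inj₂ refl) (Bf-defined (f i)))

      copair : Hom 𝔖 ∐Bf Z
      copair = record { map = λ t → copair-map ; map-cong = λ t → copair-cong _ _
                      ; pres-rel = λ _ _ () ; pres-fun = copair-pres-fun }

    ∐Bf-isCoproduct : IsCoproduct 𝔖 (λ i → Bf 𝔖 (f i)) ιB
    ∐Bf-isCoproduct Z z =
      Copair.copair Z z , (λ i s b → ≈-refl Z) , (λ _ e s x → e (proj₁ x) s (proj₂ x))

    ∐totInc : Hom 𝔖 ∐Af ∐Bf
    ∐totInc = record { map = λ t (i , a) → i , inj₁ a ; map-cong = λ t → cong inj₁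
                     ; pres-rel = λ _ _ () ; pres-fun = λ _ _ _ () }

    ∐totInc-cell : Cell 𝔖 (Tot 𝔖) ∐totInc
    ∐totInc-cell = coproduct (λ i → totInc 𝔖 (f i)) (λ i → base (tot (f i))) ιA ιB
                     ∐Af-isCoproduct ∐Bf-isCoproduct ∐totInc (λ i s a → refl)

  -- Terms over X labelled by their images in Y

  module Terms {X Y : Struct 𝔖} (g : Hom 𝔖 X Y) where

    data Term : Sort → Set where
      leaf : ∀ {s} → Elt X s → Term s
      node : (f : Fun) → ((k : Fin (farity f)) → Term (fargs f k)) → Elt Y (fres f) → Term (fres f)

    image : ∀ {s} → Term s → Elt Y s
    image {s} (leaf x) = map g s x
    image (node f ts y) = y

    data WellFormed : ∀ {s} → Term s → Set where
      leaf-wf : ∀ {s} {x : Elt X s} → WellFormed (leaf x)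
      node-wf : ∀ {f ts y} → (∀ k → WellFormed (ts k)) → fun Y f (λ k → image (ts k)) y →
                WellFormed (node f ts y)

    infix 4 _⇓_ _≈ₜ_

    data _⇓_ : ∀ {s} → Term s → Elt X s → Set where
      leaf⇓ : ∀ {s} {x c : Elt X s} → X ∋ x ≈ c → leaf x ⇓ c
      node⇓ : ∀ {f ts y c} (xs : FArgs X f) → (∀ k → ts k ⇓ xs k) → fun X f xs c → node f ts y ⇓ c

    data _≈ₜ_ : ∀ {s} → Term s → Term s → Set where
      node-cong : ∀ {f ts ts' y y'} → (∀ k → ts k ≈ₜ ts' k) → node f ts y ≈ₜ node f ts' y'
      same-value : ∀ {s} {τ σ : Term s} {c c'} → τ ⇓ c → σ ⇓ c' → X ∋ c ≈ c' → τ ≈ₜ σ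

    leaf-cong : ∀ {s} {x x' : Elt X s} → X ∋ x ≈ x' → leaf x ≈ₜ leaf x'
    leaf-cong x≈x' = same-value (leaf⇓ (≈-refl X)) (leaf⇓ (≈-refl X)) x≈x'

    leaf-≈ₜ : ∀ {s} {τ : Term s} {c} → τ ⇓ c → leaf c ≈ₜ τ
    leaf-≈ₜ ⇓c = same-value (leaf⇓ (≈-refl X)) ⇓c (≈-refl X)

    ⇓-resp : ∀ {s} {τ : Term s} {c c'} → τ ⇓ c → X ∋ c ≈ c' → τ ⇓ c'
    ⇓-resp (leaf⇓ e) e' = leaf⇓ (≈-trans X e e')
    ⇓-resp (node⇓ {f} xs ⇓xs fx) e' = node⇓ xs ⇓xs (fun-resp X f (λ k → ≈-refl X) e' fx)

    ⇓-functional : ∀ {s} {τ : Term s} {c c'} → τ ⇓ c → τ ⇓ c' → X ∋ c ≈ c'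
    ⇓-functional (leaf⇓ e) (leaf⇓ e') = ≈-trans X (≈-sym X e) e'
    ⇓-functional (node⇓ {f} xs ⇓xs fx) (node⇓ xs' ⇓xs' fx') =
      fun-functional X f (fun-resp X f (λ k → ⇓-functional (⇓xs k) (⇓xs' k)) (≈-refl X) fx) fx'

    ≈ₜ-refl : ∀ {s} (τ : Term s) → τ ≈ₜ τ
    ≈ₜ-refl (leaf x) = leaf-cong (≈-refl X)
    ≈ₜ-refl (node f ts y) = node-cong (λ k → ≈ₜ-refl (ts k))

    ≈ₜ-sym : ∀ {s} {τ σ : Term s} → τ ≈ₜ σ → σ ≈ₜ τ
    ≈ₜ-sym (node-cong e) = node-cong (λ k → ≈ₜ-sym (e k))
    ≈ₜ-sym (same-value ⇓c ⇓c' e) = same-value ⇓c' ⇓c (≈-sym X e)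

    ⇓-respˡ : ∀ {s} {τ σ : Term s} {c} → τ ≈ₜ σ → σ ⇓ c → τ ⇓ c
    ⇓-respˡ (node-cong e) (node⇓ xs ⇓xs fx) = node⇓ xs (λ k → ⇓-respˡ (e k) (⇓xs k)) fx
    ⇓-respˡ (same-value ⇓c ⇓c' e) ⇓d = ⇓-resp ⇓c (≈-trans X e (⇓-functional ⇓c' ⇓d))

    ≈ₜ-trans : ∀ {s} {τ σ ρ : Term s} → τ ≈ₜ σ → σ ≈ₜ ρ → τ ≈ₜ ρ
    ≈ₜ-trans (same-value ⇓c ⇓c' e) e' = same-value ⇓c (⇓-respˡ (≈ₜ-sym e') ⇓c') e
    ≈ₜ-trans (node-cong e) (same-value ⇓c ⇓c' e') = same-value (⇓-respˡ (node-cong e) ⇓c) ⇓c' e'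
    ≈ₜ-trans (node-cong e) (node-cong e') = node-cong (λ k → ≈ₜ-trans (e k) (e' k))

    image-⇓ : ∀ {s} {τ : Term s} {c} → WellFormed τ → τ ⇓ c → Y ∋ image τ ≈ map g s c
    image-⇓ leaf-wf (leaf⇓ e) = map-cong g _ e
    image-⇓ (node-wf {f} wfs fy) (node⇓ {c = c} xs ⇓xs fx) =
      fun-functional Y f (fun-resp Y f (λ k → image-⇓ (wfs k) (⇓xs k)) (≈-refl Y) fy) (pres-fun g f xs c fx)

    image-cong : ∀ {s} {τ σ : Term s} → WellFormed τ → WellFormed σ → τ ≈ₜ σ → Y ∋ image τ ≈ image σ
    image-cong (node-wf {f} wfs fy) (node-wf wfs' fy') (node-cong e) =
      fun-functional Y f (fun-resp Y f (λ k → image-cong (wfs k) (wfs' k) (e k)) (≈-refl Y) fy) fy'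
    image-cong wf wf' (same-value ⇓c ⇓c' e) =
      ≈-trans Y (image-⇓ wf ⇓c) (≈-trans Y (map-cong g _ e) (≈-sym Y (image-⇓ wf' ⇓c')))

    nullary-nodes-≈ₜ : ∀ {t} (f f' : Fun) → f ≡ f' → farity f ≡ 0 →
                       (e : fres f ≡ t) (e' : fres f' ≡ t) →
                       ∀ {ts ts' y y'} → subst Term e (node f ts y) ≈ₜ subst Term e' (node f' ts' y')
    nullary-nodes-≈ₜ f .f refl nullary refl refl = node-cong (λ k → ⊥-elim (¬Fin0 (subst Fin nullary k)))

    data Depth≤ : ℕ → ∀ {s} → Term s → Set where
      leaf-depth : ∀ {n s} {x : Elt X s} → Depth≤ n (leaf x)
      node-depth : ∀ {n f ts y} → (∀ k → Depth≤ n (ts k)) → Depth≤ (suc n) (node f ts y)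

    Depth≤-mono : ∀ {n m s} {τ : Term s} → n ≤ m → Depth≤ n τ → Depth≤ m τ
    Depth≤-mono _ leaf-depth = leaf-depth
    Depth≤-mono (s≤s n≤m) (node-depth ds) = node-depth (λ k → Depth≤-mono n≤m (ds k))

    Depth≤-suc : ∀ {n s} {τ : Term s} → Depth≤ n τ → Depth≤ (suc n) τ
    Depth≤-suc = Depth≤-mono (n≤1+n _)

    Depth≤-args : ∀ {n f ts y} → Depth≤ (suc n) (node f ts y) → ∀ k → Depth≤ n (ts k)
    Depth≤-args (node-depth ds) = ds

    record Elem (P : ∀ {s} → Term s → Set) (s : Sort) : Set where
      constructor el
      field
        term  : Term s
        wf    : WellFormed term
        holds : P term
    open Elem public

    TermStruct : (P : ∀ {s} → Term s → Set) → Struct 𝔖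
    TermStruct P = record
      { car = λ s → record
          { Carrier = Elem P s
          ; _≈_ = λ a b → term a ≈ₜ term b
          ; isEquivalence = record
            { refl = λ {a} → ≈ₜ-refl (term a) ; sym = ≈ₜ-sym ; trans = ≈ₜ-trans } }
      ; rel = λ p zs → Σ (PArgs X p) λ xs → (∀ k → term (zs k) ≈ₜ leaf (xs k)) × rel X p xs
      ; rel-resp = λ p e (xs , zs≈xs , r) → xs , (λ k → ≈ₜ-trans (≈ₜ-sym (e k)) (zs≈xs k)) , r
      ; fun = λ f zs z → Σ (Elt Y (fres f)) λ y →
                fun Y f (λ k → image (term (zs k))) y × term z ≈ₜ node f (λ k → term (zs k)) y
      ; fun-resp = λ f {zs} {zs'} ezs ez (y , fy , z≈) →
          y , fun-resp Y f (λ k → image-cong (wf (zs k)) (wf (zs' k)) (ezs k)) (≈-refl Y) fy ,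
          ≈ₜ-trans (≈ₜ-sym ez) (≈ₜ-trans z≈ (node-cong ezs))
      ; fun-functional = λ f (_ , _ , z≈) (_ , _ , z'≈) →
          ≈ₜ-trans z≈ (≈ₜ-trans (node-cong (λ k → ≈ₜ-refl _)) (≈ₜ-sym z'≈))
      }

  module TermModel {X Y : Struct 𝔖} (g : Hom 𝔖 X Y) where
    open Terms g

    Unbounded : ∀ {s} → Term s → Set
    Unbounded _ = ⊤

    X' : Struct 𝔖
    X' = TermStruct Unbounded

    h : Hom 𝔖 X X'
    h = record
      { map = λ s x → el (leaf x) leaf-wf tt
      ; map-cong = λ s e → leaf-cong e
      ; pres-rel = λ p xs r → xs , (λ k → ≈ₜ-refl _) , r
      ; pres-fun = λ f xs y fx → map g _ y , pres-fun g f xs y fx ,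
                    leaf-≈ₜ (node⇓ xs (λ k → leaf⇓ (≈-refl X)) fx) }

    g' : Hom 𝔖 X' Y
    g' = record
      { map = λ s e → image (term e)
      ; map-cong = λ s {a} {b} → image-cong (wf a) (wf b)
      ; pres-rel = λ p zs (xs , zs≈xs , r) →
          rel-resp Y p (λ k → ≈-sym Y (image-cong (wf (zs k)) leaf-wf (zs≈xs k))) (pres-rel g p xs r)
      ; pres-fun = λ f zs z (y , fy , z≈) →
          fun-resp Y f (λ k → ≈-refl Y)
            (≈-sym Y (image-cong (wf z) (node-wf (λ k → wf (zs k)) fy) z≈)) fy }

    g'∘h≈g : g' ∘ h ≈ₕ g
    g'∘h≈g s x = ≈-refl Y

    g'-total : TotalOver 𝔖 g'
    g'-total f zs y fy = el (node f (λ k → term (zs k)) y) (node-wf (λ k → wf (zs k)) fy) tt ,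
                         (y , fy , ≈ₜ-refl _)

    -- The depth filtration

    Level : ℕ → Struct 𝔖
    Level n = TermStruct (Depth≤ n)

    extend : ∀ n → Hom 𝔖 (Level n) (Level (suc n))
    extend n = record { map = λ s e → el (term e) (wf e) (Depth≤-suc (holds e)) ; map-cong = λ s e → e
                      ; pres-rel = λ p xs r → r ; pres-fun = λ f xs y r → r }

    module Step (n : ℕ) where

      record Instance : Set where
        constructor inst
        field
          symbol  : Fun
          args    : FArgs (Level n) symbol
          value   : Elt Y (fres symbol)
          defined : fun Y symbol (λ k → image (term (args k))) value
      open Instance
      open TotCoproduct symbol

      attach-map : ∀ {t} → AElt t → Elem (Depth≤ n) t
      attach-map (i , k , refl) = args i k

      attach : Hom 𝔖 ∐Af (Level n)
      attach = record
        { map = λ t → attach-map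
        ; map-cong = λ { t {i , k , refl} {.i , .k , refl} refl → ≈ₜ-refl _ }
        ; pres-rel = λ _ _ () ; pres-fun = λ _ _ _ () }

      new-node : (i : Instance) → Elem (Depth≤ (suc n)) (fres (symbol i))
      new-node i = el (node (symbol i) (λ k → term (args i k)) (value i))
                      (node-wf (λ k → wf (args i k)) (defined i))
                      (node-depth (λ k → holds (args i k)))

      adjoin-map : ∀ {t} → BElt t → Elem (Depth≤ (suc n)) t
      adjoin-map (i , inj₁ (k , refl)) = map (extend n) _ (args i k)
      adjoin-map (i , inj₂ refl) = new-node i

      adjoin-new : ∀ {t} i (e : fres (symbol i) ≡ t) →
                   term (adjoin-map (i , inj₂ e)) ≡ subst Term e (term (new-node i))
      adjoin-new i refl = refl

      adjoin-new-cong : ∀ {t} i j (e : fres (symbol i) ≡ t) (e' : fres (symbol j) ≡ t) →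
                        i ≡ j ⊎ (symbol i ≡ symbol j × farity (symbol i) ≡ 0) →
                        term (adjoin-map (i , inj₂ e)) ≈ₜ term (adjoin-map (j , inj₂ e'))
      adjoin-new-cong i .i refl refl (inj₁ refl) = ≈ₜ-refl _
      adjoin-new-cong i j e e' (inj₂ (same , nullary)) rewrite adjoin-new i e | adjoin-new j e' =
        nullary-nodes-≈ₜ (symbol i) (symbol j) same nullary e e'

      adjoin-cong : ∀ {t} (x y : BElt t) → eltKey x ≡ eltKey y →
                    term (adjoin-map x) ≈ₜ term (adjoin-map y)
      adjoin-cong (i , inj₁ (k , refl)) (.i , inj₁ (.k , refl)) refl = ≈ₜ-refl _
      adjoin-cong (i , inj₂ e) (j , inj₂ e') eq =
        adjoin-new-cong i j e e' (newKey-injective i j (inj₂-injective eq))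
      adjoin-cong (i , inj₁ _) (j , inj₂ _) ()
      adjoin-cong (i , inj₂ _) (j , inj₁ _) ()

      adjoin-pres-fun : ∀ g xs y → ∐BfGraph g xs y →
                        fun (Level (suc n)) g (λ k → adjoin-map (xs k)) (adjoin-map y)
      adjoin-pres-fun .(symbol i) xs y (copy i isGen isNew) =
        value i ,
        fun-resp Y (symbol i) (λ k → image-cong (wf (args i k)) (wf (adjoin-map (xs k))) (args≈ k))
          (≈-refl Y) (defined i) ,
        ≈ₜ-trans (adjoin-cong y (i , inj₂ refl) isNew) (node-cong args≈)
        where
          args≈ : ∀ k → term (args i k) ≈ₜ term (adjoin-map (xs k))
          args≈ k = adjoin-cong (i , inj₁ (k , refl)) (xs k) (sym (isGen k))

      adjoin : Hom 𝔖 ∐Bf (Level (suc n))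
      adjoin = record
        { map = λ t → adjoin-map ; map-cong = λ t → adjoin-cong _ _
        ; pres-rel = λ _ _ () ; pres-fun = adjoin-pres-fun }

      square : extend n ∘ attach ≈ₕ adjoin ∘ ∐totInc
      square s (i , k , refl) = ≈ₜ-refl _

      leafElem : ∀ {m s} → Elt X s → Elem (Depth≤ m) s
      leafElem x = el (leaf x) leaf-wf leaf-depth

      instance-of : ∀ {f ts y} → (∀ k → WellFormed (ts k)) → fun Y f (λ k → image (ts k)) y →
                    Depth≤ (suc n) (node f ts y) → Instance
      instance-of {f} {ts} {y} wfs fy d = inst f (λ k → el (ts k) (wfs k) (Depth≤-args d k)) y fy

      module Mediator (Z : Struct 𝔖) (v : Hom 𝔖 (Level n) Z) (w : Hom 𝔖 ∐Bf Z)
                      (commutes : v ∘ attach ≈ₕ w ∘ ∐totInc) where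
        instance-defined : ∀ i → fun Z (symbol i) (λ k → map v _ (args i k)) (map w _ (i , inj₂ refl))
        instance-defined i = fun-resp Z (symbol i) (λ k → ≈-sym Z (commutes _ (i , k , refl))) (≈-refl Z)
          (pres-fun w (symbol i) (λ k → i , generators (symbol i) k) (i , inj₂ refl)
            (copy i (λ k → refl) refl))

        mediate : ∀ {s} → Elem (Depth≤ (suc n)) s → Elt Z s
        mediate (el (leaf x) _ _) = map v _ (leafElem x)
        mediate (el (node f ts y) (node-wf wfs fy) d) = map w _ (instance-of wfs fy d , inj₂ refl)

        mediate-extend : ∀ {s} (ρ : Elem (Depth≤ n) s) → Z ∋ mediate (map (extend n) s ρ) ≈ map v s ρ
        mediate-extend (el (leaf x) _ _) = map-cong v _ (≈ₜ-refl _)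
        mediate-extend (el (node f ts y) (node-wf wfs fy) d) =
          fun-functional Z f
            (fun-resp Z f (λ k → map-cong v _ (≈ₜ-refl (ts k))) (≈-refl Z)
              (instance-defined (instance-of wfs fy (Depth≤-suc d))))
            (pres-fun v f (λ k → el (ts k) (wfs k) (Depth≤-args (Depth≤-suc d) k)) _ (y , fy , ≈ₜ-refl _))

        mediate-⇓ : ∀ {s} (ρ : Elem (Depth≤ (suc n)) s) {c} → term ρ ⇓ c →
                    Z ∋ mediate ρ ≈ map v s (leafElem c)
        mediate-⇓ (el (leaf x) _ _) (leaf⇓ e) = map-cong v _ (leaf-cong e)
        mediate-⇓ (el (node f ts y) (node-wf wfs fy) d) {c} (node⇓ xs ⇓xs fx) =
          fun-functional Z f
            (instance-defined (instance-of wfs fy d))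
            (pres-fun v f (λ k → el (ts k) (wfs k) (Depth≤-args d k)) (leafElem c)
               (y , fy , leaf-≈ₜ (node⇓ xs ⇓xs fx)))

        mediate-cong : ∀ {s} (a b : Elem (Depth≤ (suc n)) s) → term a ≈ₜ term b →
                       Z ∋ mediate a ≈ mediate b
        mediate-cong (el (node f ts y) (node-wf wfs fy) d) (el (node .f ts' y') (node-wf wfs' fy') d') (node-cong e) =
          fun-functional Z f
            (fun-resp Z f (λ k → map-cong v _ (e k)) (≈-refl Z) (instance-defined (instance-of wfs fy d)))
            (instance-defined (instance-of wfs' fy' d'))
        mediate-cong a b (same-value ⇓c ⇓c' e) =
          ≈-trans Z (mediate-⇓ a ⇓c)
            (≈-trans Z (map-cong v _ (leaf-cong e)) (≈-sym Z (mediate-⇓ b ⇓c')))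

        mediate-pres-fun : ∀ f (zs : FArgs (Level (suc n)) f) (z : Elem (Depth≤ (suc n)) (fres f)) →
                           fun (Level (suc n)) f zs z → fun Z f (λ k → mediate (zs k)) (mediate z)
        mediate-pres-fun f zs (el (node .f ts' _) (node-wf wfs fy) d) (_ , _ , node-cong e) =
          fun-resp Z f (λ k → ≈-trans Z (≈-sym Z (mediate-extend (arg k)))
                                 (mediate-cong (map (extend n) _ (arg k)) (zs k) (e k)))
            (≈-refl Z) (instance-defined (instance-of wfs fy d))
          where
            arg : ∀ k → Elem (Depth≤ n) (fargs f k)
            arg k = el (ts' k) (wfs k) (Depth≤-args d k)
        mediate-pres-fun f zs z (_ , _ , same-value {c' = c} ⇓z (node⇓ xs ⇓xs fx) e) =
          fun-resp Z f (λ k → ≈-sym Z (mediate-⇓ (zs k) (⇓xs k)))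
            (≈-sym Z (≈-trans Z (mediate-⇓ z ⇓z) (map-cong v _ (leaf-cong e))))
            (pres-fun v f (λ k → leafElem (xs k)) (leafElem c)
              (map g _ c , pres-fun g f xs c fx , leaf-≈ₜ (node⇓ xs (λ k → leaf⇓ (≈-refl X)) fx)))

        mediator : Hom 𝔖 (Level (suc n)) Z
        mediator = record
          { map = λ s → mediate
          ; map-cong = λ s → mediate-cong _ _
          ; pres-rel = λ p zs (xs , zs≈xs , r) →
              rel-resp Z p (λ k → ≈-sym Z (mediate-⇓ (zs k) (⇓-respˡ (zs≈xs k) (leaf⇓ (≈-refl X)))))
                (pres-rel v p (λ k → leafElem (xs k)) (xs , (λ k → ≈ₜ-refl _) , r))
          ; pres-fun = mediate-pres-fun }

        mediator-adjoin : mediator ∘ adjoin ≈ₕ w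
        mediator-adjoin s (i , inj₁ (k , refl)) =
          ≈-trans Z (mediate-extend (args i k)) (commutes _ (i , k , refl))
        mediator-adjoin s (i , inj₂ refl) = ≈-refl Z

        mediator-unique : (t : Hom 𝔖 (Level (suc n)) Z) → t ∘ extend n ≈ₕ v × t ∘ adjoin ≈ₕ w →
                          t ≈ₕ mediator
        mediator-unique t (t-extend , _) s (el (leaf x) _ _) =
          ≈-trans Z (map-cong t s (≈ₜ-refl (leaf x))) (t-extend _ (leafElem x))
        mediator-unique t (_ , t-adjoin) s (el (node f ts y) (node-wf wfs fy) d) =
          ≈-trans Z (map-cong t s {el (node f ts y) (node-wf wfs fy) d} {adjoin-map (i , inj₂ refl)}
                       (≈ₜ-refl _))
            (t-adjoin _ (i , inj₂ refl))
          where i = instance-of wfs fy d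

      extend-isPushout : IsPushout 𝔖 ∐totInc attach (extend n) adjoin
      extend-isPushout = square , λ Z v w commutes →
        let open Mediator Z v w commutes in
        mediator , ((λ s → mediate-extend) , mediator-adjoin) , mediator-unique

      extend-cell : Cell 𝔖 (Tot 𝔖) (extend n)
      extend-cell = pushout ∐totInc ∐totInc-cell attach (extend n) adjoin extend-isPushout

    open Step using (extend-cell)

    depth : ∀ {s} (τ : Term s) → Σ ℕ λ n → Depth≤ n τ
    depth (leaf x) = 0 , leaf-depth
    depth (node f ts y) with common-bound (λ k n → Depth≤ n (ts k)) Depth≤-mono (λ k → depth (ts k))
    ... | n , ds = suc n , node-depth ds

    include : ∀ n → Hom 𝔖 (Level n) X'
    include n = record { map = λ s e → el (term e) (wf e) tt ; map-cong = λ s e → e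
                       ; pres-rel = λ p xs r → r ; pres-fun = λ f xs y r → r }

    module ColimitMediator (Z : Struct 𝔖) (z : ∀ n → Hom 𝔖 (Level n) Z)
                           (cocone : ∀ n → z (suc n) ∘ extend n ≈ₕ z n) where
      cocone-stable : ∀ {s} (τ : Term s) (w : WellFormed τ) {n m} → n ≤′ m →
                      (d : Depth≤ n τ) (d' : Depth≤ m τ) →
                      Z ∋ map (z m) s (el τ w d') ≈ map (z n) s (el τ w d)
      cocone-stable τ w ≤′-refl d d' = map-cong (z _) _ (≈ₜ-refl τ)
      cocone-stable {s} τ w {m = suc m} (≤′-step n≤′m) d d' =
        ≈-trans Z (map-cong (z (suc m)) s {el τ w d'} {el τ w (Depth≤-suc d″)} (≈ₜ-refl τ))
          (≈-trans Z (cocone m s (el τ w d″)) (cocone-stable τ w n≤′m d d″))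
        where d″ = Depth≤-mono (≤′⇒≤ n≤′m) d

      cocone-level-irrelevant : ∀ {s} (τ : Term s) (w : WellFormed τ) n m
                                (d : Depth≤ n τ) (d' : Depth≤ m τ) →
                                Z ∋ map (z n) s (el τ w d) ≈ map (z m) s (el τ w d')
      cocone-level-irrelevant τ w n m d d' with ≤-total n m
      ... | inj₁ n≤m = ≈-sym Z (cocone-stable τ w (≤⇒≤′ n≤m) d d')
      ... | inj₂ m≤n = cocone-stable τ w (≤⇒≤′ m≤n) d' d

      mediate : ∀ {s} → Elem Unbounded s → Elt Z s
      mediate {s} e = map (z (proj₁ (depth (term e)))) s (el (term e) (wf e) (proj₂ (depth (term e))))

      mediate-at : ∀ {s} (e : Elem Unbounded s) n (d : Depth≤ n (term e)) →
                   Z ∋ map (z n) s (el (term e) (wf e) d) ≈ mediate e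
      mediate-at e n d = cocone-level-irrelevant (term e) (wf e) n _ d (proj₂ (depth (term e)))

      mediate-cong : ∀ {s} (a b : Elem Unbounded s) → term a ≈ₜ term b → Z ∋ mediate a ≈ mediate b
      mediate-cong {s} a b a≈b =
        ≈-trans Z (≈-sym Z (mediate-at a n (Depth≤-mono (m≤m⊔n na nb) (proj₂ (depth (term a))))))
          (≈-trans Z (map-cong (z n) s a≈b)
            (mediate-at b n (Depth≤-mono (m≤n⊔m na nb) (proj₂ (depth (term b))))))
        where
          na = proj₁ (depth (term a))
          nb = proj₁ (depth (term b))
          n = na ⊔ nb

      mediate-pres-fun : ∀ f (zs : FArgs X' f) (z' : Elem Unbounded (fres f)) → fun X' f zs z' →
                         fun Z f (λ k → mediate (zs k)) (mediate z')
      mediate-pres-fun f zs z' (y , fy , z'≈) =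
        fun-resp Z f (λ k → mediate-at (zs k) (suc n) (Depth≤-suc (ds k)))
          (≈-sym Z (mediate-cong z' (el ν (node-wf (λ k → wf (zs k)) fy) tt) z'≈))
          (pres-fun (z (suc n)) f (λ k → el (term (zs k)) (wf (zs k)) (Depth≤-suc (ds k)))
             (el ν (node-wf (λ k → wf (zs k)) fy) (node-depth ds)) (y , fy , ≈ₜ-refl _))
        where
          ν = node f (λ k → term (zs k)) y
          bound = common-bound (λ k n → Depth≤ n (term (zs k))) Depth≤-mono (λ k → depth (term (zs k)))
          n = proj₁ bound
          ds = proj₂ bound

      mediator : Hom 𝔖 X' Z
      mediator = record
        { map = λ s → mediate
        ; map-cong = λ s → mediate-cong _ _
        ; pres-rel = λ p zs (xs , zs≈xs , r) →
            rel-resp Z p (λ k → mediate-cong (el (leaf (xs k)) leaf-wf tt) (zs k) (≈ₜ-sym (zs≈xs k)))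
              (pres-rel (z 0) p (λ k → el (leaf (xs k)) leaf-wf leaf-depth) (xs , (λ k → ≈ₜ-refl _) , r))
        ; pres-fun = mediate-pres-fun }

    levels-colimit : IsSeqColimit 𝔖 Level extend include
    levels-colimit = (λ n s e → ≈ₜ-refl _) , λ Z z cocone →
      let open ColimitMediator Z z cocone in
      mediator ,
      (λ n s e → ≈-sym Z (mediate-at (el (term e) (wf e) tt) n (holds e))) ,
      (λ t t-include s e → t-include (proj₁ (depth (term e))) s (el (term e) (wf e) (proj₂ (depth (term e)))))

    include-cell : Cell 𝔖 (Tot 𝔖) (include 0)
    include-cell = sequence Level extend extend-cell include levels-colimit

    leaf-value : ∀ {s} → Elem (Depth≤ 0) s → Elt X s
    leaf-value (el (leaf x) _ _) = x
    leaf-value (el (node _ _ _) _ ())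

    leaf-value-⇓ : ∀ {s} (e : Elem (Depth≤ 0) s) {c} → term e ⇓ c → X ∋ leaf-value e ≈ c
    leaf-value-⇓ (el (leaf x) _ _) (leaf⇓ x≈c) = x≈c
    leaf-value-⇓ (el (node _ _ _) _ ()) _

    leaf-value-cong : ∀ {s} (a b : Elem (Depth≤ 0) s) → term a ≈ₜ term b →
                      X ∋ leaf-value a ≈ leaf-value b
    leaf-value-cong a b (same-value ⇓c ⇓c' c≈c') =
      ≈-trans X (leaf-value-⇓ a ⇓c) (≈-trans X c≈c' (≈-sym X (leaf-value-⇓ b ⇓c')))
    leaf-value-cong (el (node _ _ _) _ ()) _ (node-cong _)

    leaf-value-pres-fun : ∀ f (zs : FArgs (Level 0) f) z → fun (Level 0) f zs z →
                          fun X f (λ k → leaf-value (zs k)) (leaf-value z)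
    leaf-value-pres-fun f zs z (_ , _ , same-value ⇓c (node⇓ xs ⇓xs fx) c≈c') =
      fun-resp X f (λ k → ≈-sym X (leaf-value-⇓ (zs k) (⇓xs k)))
        (≈-sym X (≈-trans X (leaf-value-⇓ z ⇓c) c≈c')) fx
    leaf-value-pres-fun f zs (el (node _ _ _) _ ()) (_ , _ , node-cong _)

    evaluate₀ : Hom 𝔖 (Level 0) X
    evaluate₀ = record
      { map = λ s → leaf-value
      ; map-cong = λ s → leaf-value-cong _ _
      ; pres-rel = λ p zs (xs , zs≈xs , r) →
          rel-resp X p (λ k → ≈-sym X (leaf-value-⇓ (zs k) (⇓-respˡ (zs≈xs k) (leaf⇓ (≈-refl X))))) r
      ; pres-fun = leaf-value-pres-fun }

    leaf-value-≈ₜ : ∀ s (e : Elem (Depth≤ 0) s) → leaf (leaf-value e) ≈ₜ term e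
    leaf-value-≈ₜ _ (el (leaf x) _ _) = ≈ₜ-refl _
    leaf-value-≈ₜ _ (el (node _ _ _) _ ())

    -- evaluate₀ is an isomorphism, so h is a pushout of include 0 along it.
    h-isPushout : IsPushout 𝔖 (include 0) evaluate₀ h (idH 𝔖)
    h-isPushout = leaf-value-≈ₜ , λ Z v w commutes →
      w , ((λ s x → ≈-sym Z (commutes s (el (leaf x) leaf-wf leaf-depth))) , (λ s e → ≈-refl Z)) ,
      λ t t-commutes → proj₂ t-commutes

    h-cell : Cell 𝔖 (Tot 𝔖) h
    h-cell = pushout (include 0) include-cell evaluate₀ h (idH 𝔖) h-isPushout

proposition4p23 : (𝔖 : Signature) {X Y : Struct 𝔖} (g : Hom 𝔖 X Y) →
    Σ (Struct 𝔖) λ X' → Σ (Hom 𝔖 X X') λ h → Σ (Hom 𝔖 X' Y) λ g' →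
      _≈H_ 𝔖 (_∘H_ 𝔖 g' h) g × Cell 𝔖 (Tot 𝔖) h × TotalOver 𝔖 g' ×
      (∀ (X'' : Struct 𝔖) (k : Hom 𝔖 X X'') (g'' : Hom 𝔖 X'' Y) →
        _≈H_ 𝔖 (_∘H_ 𝔖 g'' k) g → Cell 𝔖 (Tot 𝔖) k → TotalOver 𝔖 g'' →
        Σ (Iso 𝔖 X' X'') λ φ →
          (_≈H_ 𝔖 (_∘H_ 𝔖 (proj₁ φ) h) k × _≈H_ 𝔖 (_∘H_ 𝔖 g'' (proj₁ φ)) g') ×
          (∀ (ψ : Iso 𝔖 X' X'') →
            _≈H_ 𝔖 (_∘H_ 𝔖 (proj₁ ψ) h) k → _≈H_ 𝔖 (_∘H_ 𝔖 g'' (proj₁ ψ)) g' →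
            _≈H_ 𝔖 (proj₁ ψ) (proj₁ φ)))
proposition4p23 𝔖 g =
  X' , h , g' , g'∘h≈g , h-cell , g'-total ,
  λ X'' k g'' g''∘k≈g k-cell g''-total →
    factorisation-unique {g = g} {h = h} {g'} g'∘h≈g h-cell g'-total {k} {g''} g''∘k≈g k-cell g''-total
  where
    open Factorisation 𝔖
    open TermModel g
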